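{- Let $G$ be a matroid on $[n]$ with no loops and no multiple points, $\mathbb{K}$ a field or commutative ring, and $r\ge1$. For each $r$-closed set $X$ let $\mathcal{E}^{(r)}_X$ be the $\mathbb{K}$-span of the monomials $e_S$ with $c_r(S)=X$, and let $A_{r,X}(G)=\mathcal{E}^{(r)}_X/(\mathcal{J}_r\cap\mathcal{E}^{(r)}_X)$. Then $A_r(G)=\bigoplus_{X\in L_r(G)}A_{r,X}(G)$.
   Context: $\mathcal{E}$ is the exterior algebra over $\mathbb{K}$ on $e_1,\dots,e_n$; $\partial(e_{i_1}\cdots e_{i_p})=\sum_k(-1)^{k-1}e_{i_1}\cdots\widehat{e_{i_k}}\cdots e_{i_p}$; $\mathcal{I}$ is the ideal generated by $\partial e_S$ for $S$ dependent in $G$. $\mathcal{J}_r$ is the ideal generated by the elements of $\mathcal{I}$ of degree at most $r$, and $A_r(G)=\mathcal{E}/\mathcal{J}_r$ (the degree $r$ closure). A subset of $[n]$ is $r$-closed if it contains the matroid closures of all its subsets of size $p$ for all $p\le r$; $L_r(G)$ is the set of $r$-closed sets; $c_r(S)$ is the intersection of all $r$-closed sets containing $S$. -}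

module Defs where

open import Level using (Level; _⊔_)
open import Data.Nat as ℕ using (ℕ; zero; suc; _<_; _≤_; _⊔_)
open import Data.Bool as B using (Bool; true; false; if_then_else_; _∧_; _∨_; not)
open import Data.Fin using (Fin; _<?_)
open import Data.Fin.Subset as Sub using (Subset; ⁅_⁆; _∪_; _∩_; ∣_∣; _⊆_; inside; outside)
open import Data.Fin.Subset.Properties using (_⊆?_)
open import Data.List using (List; []; _∷_; [_]; map; _++_; foldr)
open import Data.List.Base using (allFin)
open import Data.Vec using (_∷_; []; lookup; tabulate)
open import Data.Vec.Properties using (≡-dec)
open import Data.Product using (Σ-syntax; _×_)
open import Relation.Nullary.Decidable using (isYes)
open import Relation.Binary.PropositionalEquality using (_≡_; _≢_)
open import Algebra.Bundles using (CommutativeRing)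

allSubsets : (n : ℕ) → List (Subset n)
allSubsets zero    = [ [] ]
allSubsets (suc n) = map (outside ∷_) (allSubsets n) ++ map (inside ∷_) (allSubsets n)

_⊆ᵇ_ : ∀ {n} → Subset n → Subset n → Bool
p ⊆ᵇ q = isYes (p ⊆? q)

_≡ˢ_ : ∀ {n} → Subset n → Subset n → Bool
p ≡ˢ q = isYes (≡-dec B._≟_ p q)

memb : ∀ {n} → Fin n → Subset n → Bool
memb i S = lookup S i

record Matroid (n : ℕ) : Set where
  field
    indep       : Subset n → Bool
    indep-empty : indep Sub.⊥ ≡ true
    indep-down  : ∀ A B → A ⊆ B → indep B ≡ true → indep A ≡ true
    indep-aug   : ∀ A B → indep A ≡ true → indep B ≡ true → ∣ A ∣ < ∣ B ∣ →
                  Σ[ i ∈ Fin n ] (memb i B ≡ true × memb i A ≡ false × indep (A ∪ ⁅ i ⁆) ≡ true)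

module MatroidNotions {n : ℕ} (M : Matroid n) where
  open Matroid M

  rank : Subset n → ℕ
  rank A = foldr ℕ._⊔_ 0 (map (λ I → if (I ⊆ᵇ A) ∧ indep I then ∣ I ∣ else 0) (allSubsets n))

  cl : Subset n → Subset n
  cl A = tabulate (λ i → rank (A ∪ ⁅ i ⁆) ℕ.≡ᵇ rank A)

  Loopless : Set
  Loopless = ∀ i → indep ⁅ i ⁆ ≡ true

  NoMultiplePoints : Set
  NoMultiplePoints = ∀ i j → i ≢ j → indep (⁅ i ⁆ ∪ ⁅ j ⁆) ≡ true

  rClosed : ℕ → Subset n → Bool
  rClosed r X = foldr _∧_ true (map (λ T → not ((T ⊆ᵇ X) ∧ (∣ T ∣ ℕ.≤ᵇ r)) ∨ (cl T ⊆ᵇ X)) (allSubsets n))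

  cᵣ : ℕ → Subset n → Subset n
  cᵣ r S = foldr (λ X acc → if rClosed r X ∧ (S ⊆ᵇ X) then X ∩ acc else acc) Sub.⊤ (allSubsets n)

-- The exterior algebra E over a commutative ring K on e_1..e_n.
-- An element is its coefficient function on monomials e_S (S ⊆ [n]).

module Exterior {c ℓ : Level} (K : CommutativeRing c ℓ) (n : ℕ) where
  open CommutativeRing K

  E : Set c
  E = Subset n → Carrier

  _≈E_ : E → E → Set ℓ
  f ≈E g = ∀ U → f U ≈ g U

  0E : E
  0E _ = 0#

  _+E_ : E → E → E
  (f +E g) U = f U + g U

  _-E_ : E → E → E
  (f -E g) U = f U - g U

  sumK : List Carrier → Carrier
  sumK = foldr _+_ 0#

  sgn : ℕ → Carrier
  sgn zero    = 1#
  sgn (suc k) = - sgn k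

  countFin : (Fin n → Bool) → ℕ
  countFin p = foldr (λ i k → if p i then suc k else k) 0 (allFin n)

  below : Subset n → Fin n → ℕ
  below S i = countFin (λ j → memb j S ∧ isYes (j <? i))

  -- number of pairs (s,t) ∈ S × T with s > t; e_S e_T = (-1)^inv e_{S∪T} for disjoint S,T
  inv : Subset n → Subset n → ℕ
  inv S T = foldr ℕ._+_ 0 (map (λ s → if memb s S then below T s else 0) (allFin n))

  mono : Subset n → E
  mono S U = if U ≡ˢ S then 1# else 0#

  _*E_ : E → E → E
  (f *E g) U = sumK (map (λ S → sumK (map (λ T →
      if ((S ∩ T) ≡ˢ Sub.⊥) ∧ ((S ∪ T) ≡ˢ U) then sgn (inv S T) * (f S * g T) else 0#)
      (allSubsets n))) (allSubsets n))

  -- ∂ e_S = Σ_k (-1)^{k-1} e_{S ∖ i_k}, i_1 < ... < i_p the elements of S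
  ∂ : Subset n → E
  ∂ S U = sumK (map (λ i → if memb i S ∧ (U ≡ˢ (S Sub.- i)) then sgn (below S i) else 0#) (allFin n))

  data Ideal {p : Level} (P : E → Set p) : E → Set (c Level.⊔ ℓ Level.⊔ p) where
    gen  : ∀ {f} → P f → Ideal P f
    zer  : Ideal P 0E
    add  : ∀ {f g} → Ideal P f → Ideal P g → Ideal P (f +E g)
    lmul : ∀ {f} (a : E) → Ideal P f → Ideal P (a *E f)
    rmul : ∀ {f} (a : E) → Ideal P f → Ideal P (f *E a)
    resp : ∀ {f g} → f ≈E g → Ideal P f → Ideal P g

  DegLe : ℕ → E → Set ℓ
  DegLe r f = ∀ U → r < ∣ U ∣ → f U ≈ 0#

  module WithMatroid (M : Matroid n) where
    open Matroid M
    open MatroidNotions M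

    I : E → Set (c Level.⊔ ℓ)
    I = Ideal (λ f → Σ[ S ∈ Subset n ] (indep S ≡ false × f ≡ ∂ S))

    J : ℕ → E → Set (c Level.⊔ ℓ)
    J r = Ideal (λ f → I f × DegLe r f)

    InE : ℕ → Subset n → E → Set ℓ
    InE r X f = ∀ S → (cᵣ r S ≡ˢ X) ≡ false → f S ≈ 0#

    Family : ℕ → (Subset n → E) → Set ℓ
    Family r g = ∀ X → rClosed r X ≡ true → InE r X (g X)

    Φ : ℕ → (Subset n → E) → E
    Φ r g U = sumK (map (λ X → if rClosed r X then g X U else 0#) (allSubsets n))

    -- A_r(G) = ⊕_{X ∈ L_r(G)} A_{r,X}(G), i.e. the canonical map
    --   ⊕_X 𝓔^{(r)}_X/(𝓙_r ∩ 𝓔^{(r)}_X) → 𝓔/𝓙_r ,  (g_X)_X ↦ Σ_X g_X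
    -- is well defined, surjective and injective.
    DirectSumDecomposition : ℕ → Set (c Level.⊔ ℓ)
    DirectSumDecomposition r =
      (∀ g g' → Family r g → Family r g' →
         (∀ X → rClosed r X ≡ true → J r (g X -E g' X)) → J r (Φ r g -E Φ r g'))
      × (∀ f → Σ[ g ∈ (Subset n → E) ] (Family r g × J r (f -E Φ r g)))
      × (∀ g → Family r g → J r (Φ r g) → ∀ X → rClosed r X ≡ true → J r (g X))

{-# OPTIONS --safe #-}
module Submission where

-- Grade 𝓔 by the weight w(U) = (c_r(U), |U|) of the monomial e_U, and let π_P keep exactly the
-- coefficients of the monomials whose weight satisfies P. Because c_r(S ∪ c_r(T)) = c_r(S ∪ T), the
-- weight of e_S e_T (S, T disjoint) is determined by S and w(T), so π_P(a f) = Σ_S a_S e_S π_P′(f) for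
-- shifted predicates P′; by induction on ideal membership it therefore suffices to see that π_P maps
-- generators into 𝓙_r. A generator of 𝓙_r has degree ≤ r, so only predicates living in degrees ≤ r
-- matter, and the same induction reduces to the generators ∂e_S of 𝓘 with S dependent. If S - i is
-- independent, then i ∈ cl(S - i), so all independent faces S - i of size ≤ r have the same weight
-- (c_r(S), |S| - 1); the remaining faces of size ≤ r are dependent, and e_D = ±e_j ∂e_D ∈ 𝓙_r for a
-- dependent D of size ≤ r and j ∈ D. Hence π_P(∂e_S) is ∂e_S or 0 modulo 𝓙_r. Taking P to be "c_r = X"
-- shows that 𝓙_r is the direct sum of the 𝓙_r ∩ 𝓔^(r)_X, which is the claimed decomposition of A_r(G).

open import Defs
open import Level using (Level)
open import Data.Nat using (ℕ; _≤_)
open import Algebra.Bundles using (CommutativeRing)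

open import Algebra.Bundles using (CommutativeMonoid; AbelianGroup)
open import Data.Nat as ℕ using (zero; suc; _<_; z≤n)
import Data.Nat.Properties as ℕ
open import Data.Bool as Bool using (Bool; true; false; not; _∧_; _∨_; if_then_else_)
open import Data.Bool.Properties using (T-≡; if-float; not-¬; not-injective)
open import Data.Fin as Fin using (Fin)
import Data.Fin.Properties as Fin
open import Data.Fin.Subset as Sub using (Subset; inside; outside; ∣_∣; ⁅_⁆; _∪_; _∩_; _─_; _-_; _∈_; _∉_; _⊆_; Nonempty)
open import Data.Fin.Subset.Properties
  using (_⊆?_; _∈?_; ⊆-refl; ⊆-trans; ⊆-antisym; ⊆⊤; ∈⊤; ∉⊥; x∈⁅x⁆; x∈⁅y⁆⇒x≡y; ∣⁅x⁆∣≡1; Empty-unique; nonempty?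
        ; ∩-comm; ∪-comm; ∩-zeroˡ; ∪-identityˡ; p∩q⊆p; p∩q⊆q; p⊆p∪q; q⊆p∪q; x∈p∩q⁺; x∈p∩q⁻; x∈p∪q⁺; x∈p∪q⁻
        ; p─q⊆p; x∈p∧x≢y⇒x∈p-y; p⊆q⇒∣p∣≤∣q∣; p⊂q⇒∣p∣<∣q∣)
open import Data.List using (List; []; _∷_; map; foldr; allFin)
open import Data.List.Membership.Propositional using () renaming (_∈_ to _∈ₗ_)
import Data.List.Membership.Propositional.Properties as ∈ₗ
open import Data.List.Relation.Unary.All as All using (All; []; _∷_)
open import Data.List.Relation.Unary.All.Properties using (all⁺; all⁻)
import Data.List.Relation.Unary.AllPairs as AllPairs
import Data.List.Relation.Unary.Any as Any
open import Data.List.Relation.Unary.Unique.Propositional using (Unique; []; _∷_)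
import Data.List.Relation.Unary.Unique.Propositional.Properties as Uniqueₚ
open import Data.Product using (_×_; _,_; proj₁)
open import Data.Sum using (inj₁; inj₂)
open import Data.Unit using (⊤; tt)
open import Data.Vec using (_∷_; []; here; there)
import Data.Vec.Properties as Vec
open import Function using (_∘_; case_of_)
open import Function.Bundles using (Equivalence)
open import Relation.Nullary using (Dec; yes; no; ¬_; contradiction)
open import Relation.Nullary.Decidable using (isYes; _×-dec_; ¬?; toWitness; fromWitness)
open import Relation.Binary.PropositionalEquality as ≡ using (_≡_; _≢_; refl; cong; cong₂)

module ListSum {c ℓ} (M : CommutativeMonoid c ℓ) where
  open CommutativeMonoid M renaming (_∙_ to _+_; ε to 0#; refl to ≈-refl; sym to ≈-sym; trans to ≈-trans)
  open import Algebra.Properties.CommutativeSemigroup commutativeSemigroup using (interchange)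
  open import Relation.Binary.Reasoning.Setoid setoid

  ∑ : {A : Set} → List A → (A → Carrier) → Carrier
  ∑ xs h = foldr _+_ 0# (map h xs)

  module _ {A : Set} where

    ∑-cong : ∀ (xs : List A) {h k : A → Carrier} → (∀ x → h x ≈ k x) → ∑ xs h ≈ ∑ xs k
    ∑-cong []       h≈k = ≈-refl
    ∑-cong (x ∷ xs) h≈k = ∙-cong (h≈k x) (∑-cong xs h≈k)

    ∑-zero-on : ∀ (xs : List A) {h : A → Carrier} → All (λ x → h x ≈ 0#) xs → ∑ xs h ≈ 0#
    ∑-zero-on []       []            = ≈-refl
    ∑-zero-on (x ∷ xs) (hx≈0 ∷ rest) = ≈-trans (∙-cong hx≈0 (∑-zero-on xs rest)) (identityˡ 0#)

    ∑-zero : ∀ (xs : List A) {h : A → Carrier} → (∀ x → h x ≈ 0#) → ∑ xs h ≈ 0#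
    ∑-zero xs h≈0 = ∑-zero-on xs (All.tabulate (λ {x} _ → h≈0 x))

    ∑-+ : ∀ (xs : List A) (h k : A → Carrier) → ∑ xs (λ x → h x + k x) ≈ ∑ xs h + ∑ xs k
    ∑-+ []       h k = ≈-sym (identityˡ 0#)
    ∑-+ (x ∷ xs) h k = ≈-trans (∙-congˡ (∑-+ xs h k)) (interchange (h x) (k x) _ _)

    ∑-if : ∀ (xs : List A) b (h : A → Carrier) → ∑ xs (λ x → if b then h x else 0#) ≈ (if b then ∑ xs h else 0#)
    ∑-if xs true  h = ≈-refl
    ∑-if xs false h = ∑-zero xs (λ _ → ≈-refl)

    ∑-single : ∀ (xs : List A) {x} (h : A → Carrier) → Unique xs → x ∈ₗ xs → (∀ y → y ≢ x → h y ≈ 0#) →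
               ∑ xs h ≈ h x
    ∑-single (x ∷ xs) h (x≢xs ∷ _) (Any.here refl) others = begin
      h x + ∑ xs h ≈⟨ ∙-congˡ (∑-zero-on xs (All.map (λ x≢y → others _ (λ y≡x → x≢y (≡.sym y≡x))) x≢xs)) ⟩
      h x + 0#     ≈⟨ identityʳ (h x) ⟩
      h x          ∎
    ∑-single (y ∷ xs) {x} h (y≢xs ∷ unique) (Any.there x∈xs) others = begin
      h y + ∑ xs h ≈⟨ ∙-cong (others y (All.lookup y≢xs x∈xs)) (∑-single xs h unique x∈xs others) ⟩
      0# + h x     ≈⟨ identityˡ (h x) ⟩
      h x          ∎

  ∑-comm : ∀ {A B : Set} (xs : List A) (ys : List B) (h : A → B → Carrier) →
           ∑ xs (λ x → ∑ ys (h x)) ≈ ∑ ys (λ y → ∑ xs (λ x → h x y))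
  ∑-comm []       ys h = ≈-sym (∑-zero ys (λ _ → ≈-refl))
  ∑-comm (x ∷ xs) ys h = ≈-trans (∙-congˡ (∑-comm xs ys h)) (≈-sym (∑-+ ys (h x) _))

module AbelianListSum {c ℓ} (G : AbelianGroup c ℓ) where
  open AbelianGroup G renaming (_∙_ to _+_; _⁻¹ to -_; ε to 0#; refl to ≈-refl; sym to ≈-sym; trans to ≈-trans)
  open import Algebra.Properties.AbelianGroup G using (⁻¹-∙-comm; ε⁻¹≈ε)
  open ListSum commutativeMonoid public

  ∑-neg : ∀ {A : Set} (xs : List A) (h : A → Carrier) → ∑ xs (λ x → - h x) ≈ - ∑ xs h
  ∑-neg []       h = ≈-sym ε⁻¹≈ε
  ∑-neg (x ∷ xs) h = ≈-trans (∙-congˡ (∑-neg xs h)) (⁻¹-∙-comm (h x) _)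

  ∑-sub : ∀ {A : Set} (xs : List A) (h k : A → Carrier) → ∑ xs (λ x → h x + - k x) ≈ ∑ xs h + - ∑ xs k
  ∑-sub xs h k = ≈-trans (∑-+ xs h (λ x → - k x)) (∙-congˡ (∑-neg xs k))

module _ {a} {A : Set a} where

  isYes⇒ : (d : Dec A) → isYes d ≡ true → A
  isYes⇒ (yes a) _ = a

  isYes⁺ : (d : Dec A) → A → isYes d ≡ true
  isYes⁺ (yes _) _ = refl
  isYes⁺ (no ¬a) a = contradiction a ¬a

  isYes⁻ : (d : Dec A) → ¬ A → isYes d ≡ false
  isYes⁻ (yes a) ¬a = contradiction a ¬a
  isYes⁻ (no _)  _  = refl

implies-elim : ∀ {a b c} → Bool.T (not (a ∧ b) ∨ c) → Bool.T a → Bool.T b → Bool.T c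
implies-elim {true} {true} c _ _ = c

implies-intro : ∀ {a b c} → (Bool.T a → Bool.T b → Bool.T c) → Bool.T (not (a ∧ b) ∨ c)
implies-intro {true}  {true}  f = f _ _
implies-intro {true}  {false} f = _
implies-intro {false}         f = _

module _ {n : ℕ} {p q : Subset n} where

  ≡ˢ⇒≡ : (p ≡ˢ q) ≡ true → p ≡ q
  ≡ˢ⇒≡ = isYes⇒ (Vec.≡-dec Bool._≟_ p q)

  ≡⇒≡ˢ : p ≡ q → (p ≡ˢ q) ≡ true
  ≡⇒≡ˢ = isYes⁺ (Vec.≡-dec Bool._≟_ p q)

  ≢⇒≡ˢ-false : p ≢ q → (p ≡ˢ q) ≡ false
  ≢⇒≡ˢ-false = isYes⁻ (Vec.≡-dec Bool._≟_ p q)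

  ⊆⇒⊆ᵇ : p ⊆ q → (p ⊆ᵇ q) ≡ true
  ⊆⇒⊆ᵇ = isYes⁺ (p ⊆? q)

memb⇒∈ : ∀ {n} {i : Fin n} {p} → memb i p ≡ true → i ∈ p
memb⇒∈ {i = i} {p} = Vec.lookup⇒[]= i p

allSubsets-complete : ∀ n (p : Subset n) → p ∈ₗ allSubsets n
allSubsets-complete zero    []            = Any.here refl
allSubsets-complete (suc n) (outside ∷ p) = ∈ₗ.∈-++⁺ˡ (∈ₗ.∈-map⁺ (outside ∷_) (allSubsets-complete n p))
allSubsets-complete (suc n) (inside ∷ p)  = ∈ₗ.∈-++⁺ʳ _ (∈ₗ.∈-map⁺ (inside ∷_) (allSubsets-complete n p))

allSubsets-unique : ∀ n → Unique (allSubsets n)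
allSubsets-unique zero    = All.[] AllPairs.∷ AllPairs.[]
allSubsets-unique (suc n) = Uniqueₚ.++⁺ (Uniqueₚ.map⁺ Vec.∷-injectiveʳ (allSubsets-unique n))
                                       (Uniqueₚ.map⁺ Vec.∷-injectiveʳ (allSubsets-unique n))
                                       outside≢inside
  where
  outside≢inside : ∀ {p} → ¬ (p ∈ₗ map (outside ∷_) (allSubsets n) × p ∈ₗ map (inside ∷_) (allSubsets n))
  outside≢inside (p∈out , p∈in) with ∈ₗ.∈-map⁻ (outside ∷_) p∈out | ∈ₗ.∈-map⁻ (inside ∷_) p∈in
  ... | _ , _ , refl | _ , _ , ()

x∈q⇒x∉p─q : ∀ {n} {x : Fin n} {p q} → x ∈ q → x ∉ p ─ q
x∈q⇒x∉p─q {p = _ ∷ p} {inside ∷ q}  here        ()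
x∈q⇒x∉p─q {p = _ ∷ p} {_ ∷ q}       (there x∈q) (there x∈p─q) = x∈q⇒x∉p─q x∈q x∈p─q

∣p∪q∣≡∣p∣+∣q∣ : ∀ {n} (p q : Subset n) → p ∩ q ≡ Sub.⊥ → ∣ p ∪ q ∣ ≡ ∣ p ∣ ℕ.+ ∣ q ∣
∣p∪q∣≡∣p∣+∣q∣ []            []            _        = refl
∣p∪q∣≡∣p∣+∣q∣ (inside ∷ p)  (inside ∷ q)  ()
∣p∪q∣≡∣p∣+∣q∣ (inside ∷ p)  (outside ∷ q) disjoint = cong suc (∣p∪q∣≡∣p∣+∣q∣ p q (Vec.∷-injectiveʳ disjoint))
∣p∪q∣≡∣p∣+∣q∣ (outside ∷ p) (inside ∷ q)  disjoint =
  ≡.trans (cong suc (∣p∪q∣≡∣p∣+∣q∣ p q (Vec.∷-injectiveʳ disjoint))) (≡.sym (ℕ.+-suc ∣ p ∣ ∣ q ∣))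
∣p∪q∣≡∣p∣+∣q∣ (outside ∷ p) (outside ∷ q) disjoint = ∣p∪q∣≡∣p∣+∣q∣ p q (Vec.∷-injectiveʳ disjoint)

module _ {n : ℕ} where

  x∉p-x : ∀ {x : Fin n} p → x ∉ p - x
  x∉p-x {x} p = x∈q⇒x∉p─q (x∈⁅x⁆ x)

  x∈p-y⇒x≢y : ∀ {x y : Fin n} {p} → x ∈ p - y → x ≢ y
  x∈p-y⇒x≢y {p = p} x∈p-y refl = x∉p-x p x∈p-y

  p-x≡p-y⇒x≡y : ∀ {x y : Fin n} {p} → y ∈ p → p - x ≡ p - y → x ≡ y
  p-x≡p-y⇒x≡y {x} {y} {p} y∈p eq with y Fin.≟ x
  ... | yes y≡x = ≡.sym y≡x
  ... | no  y≢x = contradiction (≡.subst (y ∈_) eq (x∈p∧x≢y⇒x∈p-y y∈p y≢x)) (x∉p-x p)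

  ⁅x⁆∪[p-x]≡p : ∀ {x : Fin n} {p} → x ∈ p → ⁅ x ⁆ ∪ (p - x) ≡ p
  ⁅x⁆∪[p-x]≡p {x} {p} x∈p = ⊆-antisym ⊆p p⊆
    where
    ⊆p : ⁅ x ⁆ ∪ (p - x) ⊆ p
    ⊆p y∈ with x∈p∪q⁻ ⁅ x ⁆ (p - x) y∈
    ... | inj₁ y∈⁅x⁆ rewrite x∈⁅y⁆⇒x≡y x y∈⁅x⁆ = x∈p
    ... | inj₂ y∈p-x = p─q⊆p p ⁅ x ⁆ y∈p-x
    p⊆ : p ⊆ ⁅ x ⁆ ∪ (p - x)
    p⊆ {y} y∈p with y Fin.≟ x
    ... | yes refl = x∈p∪q⁺ (inj₁ (x∈⁅x⁆ x))
    ... | no  y≢x  = x∈p∪q⁺ (inj₂ (x∈p∧x≢y⇒x∈p-y y∈p y≢x))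

  ⁅x⁆∩[p-x]≡⊥ : ∀ (x : Fin n) p → ⁅ x ⁆ ∩ (p - x) ≡ Sub.⊥
  ⁅x⁆∩[p-x]≡⊥ x p = Empty-unique λ { (y , y∈∩) → let y∈⁅x⁆ , y∈p-x = x∈p∩q⁻ ⁅ x ⁆ (p - x) y∈∩
                                                  in x∈p-y⇒x≢y y∈p-x (x∈⁅y⁆⇒x≡y x y∈⁅x⁆) }

  ∣p∣≡1+∣p-x∣ : ∀ {x : Fin n} {p} → x ∈ p → ∣ p ∣ ≡ suc ∣ p - x ∣
  ∣p∣≡1+∣p-x∣ {x} {p} x∈p = begin
    ∣ p ∣                   ≡⟨ cong ∣_∣ (⁅x⁆∪[p-x]≡p x∈p) ⟨
    ∣ ⁅ x ⁆ ∪ (p - x) ∣     ≡⟨ ∣p∪q∣≡∣p∣+∣q∣ ⁅ x ⁆ (p - x) (⁅x⁆∩[p-x]≡⊥ x p) ⟩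
    ∣ ⁅ x ⁆ ∣ ℕ.+ ∣ p - x ∣ ≡⟨ cong (ℕ._+ ∣ p - x ∣) (∣⁅x⁆∣≡1 x) ⟩
    suc ∣ p - x ∣           ∎
    where open ≡.≡-Reasoning

  ∣p-x∣≡∣p∣∸1 : ∀ {x : Fin n} {p} → x ∈ p → ∣ p - x ∣ ≡ ∣ p ∣ ℕ.∸ 1
  ∣p-x∣≡∣p∣∸1 x∈p = ≡.sym (cong (ℕ._∸ 1) (∣p∣≡1+∣p-x∣ x∈p))

  p⊆q∧p≢q⇒∣p∣<∣q∣ : ∀ {p q : Subset n} → p ⊆ q → p ≢ q → ∣ p ∣ < ∣ q ∣
  p⊆q∧p≢q⇒∣p∣<∣q∣ {p} {q} p⊆q p≢q with Fin.any? (λ x → x ∈? q ×-dec ¬? (x ∈? p))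
  ... | yes (x , x∈q , x∉p) = p⊂q⇒∣p∣<∣q∣ (p⊆q , x , x∈q , x∉p)
  ... | no  ∄x              = contradiction (⊆-antisym p⊆q q⊆p) p≢q
    where
    q⊆p : q ⊆ p
    q⊆p {x} x∈q with x ∈? p
    ... | yes x∈p = x∈p
    ... | no  x∉p = contradiction (x , x∈q , x∉p) ∄x

  ⁅x⁆∩p≡⊥⇒x∉p : ∀ {x : Fin n} {p} → ⁅ x ⁆ ∩ p ≡ Sub.⊥ → x ∉ p
  ⁅x⁆∩p≡⊥⇒x∉p {x} ⁅x⁆∩p≡⊥ x∈p = ∉⊥ (≡.subst (x ∈_) ⁅x⁆∩p≡⊥ (x∈p∩q⁺ (x∈⁅x⁆ x , x∈p)))

module Hull {n : ℕ} (closed : Subset n → Bool) where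

  hull : List (Subset n) → Subset n → Subset n
  hull Xs S = foldr (λ X acc → if closed X ∧ (S ⊆ᵇ X) then X ∩ acc else acc) Sub.⊤ Xs

  ⊆-hull : ∀ Xs S → S ⊆ hull Xs S
  ⊆-hull []       S x∈S = ∈⊤
  ⊆-hull (X ∷ Xs) S x∈S with closed X | S ⊆? X
  ... | true  | yes S⊆X = x∈p∩q⁺ (S⊆X x∈S , ⊆-hull Xs S x∈S)
  ... | true  | no  _   = ⊆-hull Xs S x∈S
  ... | false | _       = ⊆-hull Xs S x∈S

  hull-least : ∀ Xs S {X} → X ∈ₗ Xs → closed X ≡ true → S ⊆ X → hull Xs S ⊆ X
  hull-least (X ∷ Xs) S (Any.here refl) X-closed S⊆X rewrite X-closed | ⊆⇒⊆ᵇ S⊆X = p∩q⊆p X _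
  hull-least (Y ∷ Xs) S (Any.there X∈Xs) X-closed S⊆X with closed Y | S ⊆? Y
  ... | true  | yes _ = ⊆-trans (p∩q⊆q Y _) (hull-least Xs S X∈Xs X-closed S⊆X)
  ... | true  | no  _ = hull-least Xs S X∈Xs X-closed S⊆X
  ... | false | _     = hull-least Xs S X∈Xs X-closed S⊆X

  hull-closed : closed Sub.⊤ ≡ true → (∀ X Y → closed X ≡ true → closed Y ≡ true → closed (X ∩ Y) ≡ true) →
                ∀ Xs S → closed (hull Xs S) ≡ true
  hull-closed ⊤-closed ∩-closed []       S = ⊤-closed
  hull-closed ⊤-closed ∩-closed (X ∷ Xs) S with closed X in X-closed | S ⊆? X
  ... | true  | yes _ = ∩-closed X _ X-closed (hull-closed ⊤-closed ∩-closed Xs S)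
  ... | true  | no  _ = hull-closed ⊤-closed ∩-closed Xs S
  ... | false | _     = hull-closed ⊤-closed ∩-closed Xs S

module _ {A : Set} (f : A → ℕ) where

  ≤-foldr-⊔ : ∀ {xs x} → x ∈ₗ xs → f x ≤ foldr ℕ._⊔_ 0 (map f xs)
  ≤-foldr-⊔ {y ∷ xs} (Any.here refl)  = ℕ.m≤m⊔n (f y) _
  ≤-foldr-⊔ {y ∷ xs} (Any.there x∈xs) = ℕ.≤-trans (≤-foldr-⊔ x∈xs) (ℕ.m≤n⊔m (f y) _)

  foldr-⊔-≤ : ∀ xs {m} → (∀ x → f x ≤ m) → foldr ℕ._⊔_ 0 (map f xs) ≤ m
  foldr-⊔-≤ []       f≤m = z≤n
  foldr-⊔-≤ (x ∷ xs) f≤m = ℕ.⊔-lub (f≤m x) (foldr-⊔-≤ xs f≤m)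

module Rank {n : ℕ} (M : Matroid n) where
  open Matroid M
  open MatroidNotions M

  ∣I∣≤rank : ∀ {I A} → I ⊆ A → indep I ≡ true → ∣ I ∣ ≤ rank A
  ∣I∣≤rank {I} {A} I⊆A I-indep = ≡.subst (_≤ rank A) value (≤-foldr-⊔ candidate (allSubsets-complete n I))
    where
    candidate : Subset n → ℕ
    candidate J = if (J ⊆ᵇ A) ∧ indep J then ∣ J ∣ else 0
    value : candidate I ≡ ∣ I ∣
    value rewrite ⊆⇒⊆ᵇ I⊆A | I-indep = refl

  rank≤ : ∀ {A m} → (∀ I → I ⊆ A → indep I ≡ true → ∣ I ∣ ≤ m) → rank A ≤ m
  rank≤ {A} bound = foldr-⊔-≤ _ (allSubsets n) candidate≤
    where
    candidate≤ : ∀ I → (if (I ⊆ᵇ A) ∧ indep I then ∣ I ∣ else 0) ≤ _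
    candidate≤ I with I ⊆? A | indep I in I-indep
    ... | yes I⊆A | true  = bound I I⊆A I-indep
    ... | yes _   | false = z≤n
    ... | no  _   | _     = z≤n

  rank-indep : ∀ {A} → indep A ≡ true → rank A ≡ ∣ A ∣
  rank-indep A-indep = ℕ.≤-antisym (rank≤ (λ _ I⊆A _ → p⊆q⇒∣p∣≤∣q∣ I⊆A)) (∣I∣≤rank ⊆-refl A-indep)

  module _ {S x} (S-dep : indep S ≡ false) (x∈S : x ∈ S) (S-x-indep : indep (S - x) ≡ true) where

    rank≡∣S-x∣ : rank S ≡ ∣ S - x ∣
    rank≡∣S-x∣ = ℕ.≤-antisym (rank≤ bound) (∣I∣≤rank (p─q⊆p S ⁅ x ⁆) S-x-indep)
      where
      bound : ∀ I → I ⊆ S → indep I ≡ true → ∣ I ∣ ≤ ∣ S - x ∣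
      bound I I⊆S I-indep = ℕ.≤-pred (≡.subst (∣ I ∣ <_) (∣p∣≡1+∣p-x∣ x∈S) (p⊆q∧p≢q⇒∣p∣<∣q∣ I⊆S I≢S))
        where
        I≢S : I ≢ S
        I≢S refl = contradiction (≡.trans (≡.sym I-indep) S-dep) λ ()

    x∈cl[S-x] : x ∈ cl (S - x)
    x∈cl[S-x] = memb⇒∈ (≡.trans (Vec.lookup∘tabulate _ x) (Equivalence.to T-≡ (ℕ.≡⇒≡ᵇ _ _ rank-same)))
      where
      rank-same : rank ((S - x) ∪ ⁅ x ⁆) ≡ rank (S - x)
      rank-same = begin
        rank ((S - x) ∪ ⁅ x ⁆) ≡⟨ cong rank (≡.trans (∪-comm (S - x) ⁅ x ⁆) (⁅x⁆∪[p-x]≡p x∈S)) ⟩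
        rank S                 ≡⟨ rank≡∣S-x∣ ⟩
        ∣ S - x ∣              ≡⟨ rank-indep S-x-indep ⟨
        rank (S - x)           ∎
        where open ≡.≡-Reasoning

module RClosure {n : ℕ} (M : Matroid n) (r : ℕ) where
  open Matroid M
  open MatroidNotions M
  open Hull (rClosed r)
  open Rank M

  IsRClosed : Subset n → Set
  IsRClosed X = ∀ T → T ⊆ X → ∣ T ∣ ≤ r → cl T ⊆ X

  closureCondition : Subset n → Subset n → Bool
  closureCondition X T = not ((T ⊆ᵇ X) ∧ (∣ T ∣ ℕ.≤ᵇ r)) ∨ (cl T ⊆ᵇ X)

  rClosed⇒IsRClosed : ∀ {X} → rClosed r X ≡ true → IsRClosed X
  rClosed⇒IsRClosed {X} X-closed T T⊆X ∣T∣≤r =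
    toWitness (implies-elim {T ⊆ᵇ X} {∣ T ∣ ℕ.≤ᵇ r} {cl T ⊆ᵇ X}
      (All.lookup (all⁺ (closureCondition X) (allSubsets n) (Equivalence.from T-≡ X-closed)) (allSubsets-complete n T))
      (fromWitness (λ {x} → T⊆X {x})) (ℕ.≤⇒≤ᵇ ∣T∣≤r))

  IsRClosed⇒rClosed : ∀ {X} → IsRClosed X → rClosed r X ≡ true
  IsRClosed⇒rClosed {X} X-closed = Equivalence.to T-≡ (all⁻ (closureCondition X) {allSubsets n} (All.tabulate (λ {T} _ →
    implies-intro {T ⊆ᵇ X} {∣ T ∣ ℕ.≤ᵇ r} {cl T ⊆ᵇ X}
      (λ T⊆X ∣T∣≤r → fromWitness (λ {x} → X-closed T (λ {y} → toWitness T⊆X {y}) (ℕ.≤ᵇ⇒≤ _ r ∣T∣≤r) {x})))))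

  ⊤-IsRClosed : IsRClosed Sub.⊤
  ⊤-IsRClosed _ _ _ = ⊆⊤

  ∩-IsRClosed : ∀ {X Y} → IsRClosed X → IsRClosed Y → IsRClosed (X ∩ Y)
  ∩-IsRClosed {X} {Y} X-closed Y-closed T T⊆X∩Y ∣T∣≤r x∈clT =
    x∈p∩q⁺ (X-closed T (⊆-trans T⊆X∩Y (p∩q⊆p X Y)) ∣T∣≤r x∈clT , Y-closed T (⊆-trans T⊆X∩Y (p∩q⊆q X Y)) ∣T∣≤r x∈clT)

  S⊆cᵣS : ∀ S → S ⊆ cᵣ r S
  S⊆cᵣS = ⊆-hull (allSubsets n)

  cᵣ-rClosed : ∀ S → rClosed r (cᵣ r S) ≡ true
  cᵣ-rClosed = hull-closed (IsRClosed⇒rClosed ⊤-IsRClosed)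
    (λ X Y X-closed Y-closed → IsRClosed⇒rClosed (∩-IsRClosed (rClosed⇒IsRClosed X-closed) (rClosed⇒IsRClosed Y-closed)))
    (allSubsets n)

  cᵣ-IsRClosed : ∀ S → IsRClosed (cᵣ r S)
  cᵣ-IsRClosed S = rClosed⇒IsRClosed (cᵣ-rClosed S)

  cᵣ-least : ∀ {S X} → IsRClosed X → S ⊆ X → cᵣ r S ⊆ X
  cᵣ-least {S} {X} X-closed = hull-least (allSubsets n) S (allSubsets-complete n X) (IsRClosed⇒rClosed X-closed)

  cᵣ-mono : ∀ {S T} → S ⊆ T → cᵣ r S ⊆ cᵣ r T
  cᵣ-mono {S} {T} S⊆T = cᵣ-least (cᵣ-IsRClosed T) (⊆-trans S⊆T (S⊆cᵣS T))

  cᵣ[S∪cᵣT]≡cᵣ[S∪T] : ∀ S T → cᵣ r (S ∪ cᵣ r T) ≡ cᵣ r (S ∪ T)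
  cᵣ[S∪cᵣT]≡cᵣ[S∪T] S T = ⊆-antisym (cᵣ-least (cᵣ-IsRClosed (S ∪ T)) S∪cᵣT⊆) (cᵣ-mono S∪T⊆)
    where
    S∪cᵣT⊆ : S ∪ cᵣ r T ⊆ cᵣ r (S ∪ T)
    S∪cᵣT⊆ x∈ with x∈p∪q⁻ S (cᵣ r T) x∈
    ... | inj₁ x∈S   = S⊆cᵣS (S ∪ T) (p⊆p∪q T x∈S)
    ... | inj₂ x∈cᵣT = cᵣ-mono (q⊆p∪q S T) x∈cᵣT
    S∪T⊆ : S ∪ T ⊆ S ∪ cᵣ r T
    S∪T⊆ x∈ with x∈p∪q⁻ S T x∈
    ... | inj₁ x∈S = p⊆p∪q (cᵣ r T) x∈S
    ... | inj₂ x∈T = q⊆p∪q S (cᵣ r T) (S⊆cᵣS T x∈T)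

  cᵣ[S-x]≡cᵣS : ∀ {S x} → indep S ≡ false → x ∈ S → indep (S - x) ≡ true → ∣ S - x ∣ ≤ r → cᵣ r (S - x) ≡ cᵣ r S
  cᵣ[S-x]≡cᵣS {S} {x} S-dep x∈S S-x-indep ∣S-x∣≤r = ⊆-antisym (cᵣ-mono (p─q⊆p S ⁅ x ⁆)) (cᵣ-least (cᵣ-IsRClosed (S - x)) S⊆)
    where
    S⊆ : S ⊆ cᵣ r (S - x)
    S⊆ {y} y∈S with y Fin.≟ x
    ... | yes refl = cᵣ-IsRClosed (S - x) (S - x) (S⊆cᵣS (S - x)) ∣S-x∣≤r (x∈cl[S-x] S-dep x∈S S-x-indep)
    ... | no  y≢x  = S⊆cᵣS (S - x) (x∈p∧x≢y⇒x∈p-y y∈S y≢x)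

module ExteriorAlgebra {c ℓ : Level} (K : CommutativeRing c ℓ) (n : ℕ) where
  open CommutativeRing K hiding (_-_) renaming (refl to ≈-refl; sym to ≈-sym; trans to ≈-trans; reflexive to ≈-reflexive)
  open import Algebra.Properties.Ring ring using (-1*x≈-x; -‿distribˡ-*; -‿distribʳ-*; -‿involutive)
  open import Relation.Binary.Reasoning.Setoid setoid
  open AbelianListSum +-abelianGroup
  open Exterior K n

  subsets : List (Subset n)
  subsets = allSubsets n

  ∑-subsets-single : ∀ (h : Subset n → Carrier) S → (∀ T → T ≢ S → h T ≈ 0#) → ∑ subsets h ≈ h S
  ∑-subsets-single h S = ∑-single subsets h (allSubsets-unique n) (allSubsets-complete n S)

  ∑-allFin-single : ∀ (h : Fin n → Carrier) i → (∀ j → j ≢ i → h j ≈ 0#) → ∑ (allFin n) h ≈ h i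
  ∑-allFin-single h i = ∑-single (allFin n) h (Uniqueₚ.allFin⁺ n) (∈ₗ.∈-allFin i)

  sumE : {A : Set} → List A → (A → E) → E
  sumE xs h U = ∑ xs (λ x → h x U)

  if-0-cong : ∀ b {x y} → x ≈ y → (if b then x else 0#) ≈ (if b then y else 0#)
  if-0-cong true  x≈y = x≈y
  if-0-cong false _   = ≈-refl

  if-0-idem : ∀ b → (if b then 0# else 0#) ≈ 0#
  if-0-idem true  = ≈-refl
  if-0-idem false = ≈-refl

  if-0E-at : ∀ b (f : E) U → (if b then f else 0E) U ≡ (if b then f U else 0#)
  if-0E-at b f U = if-float (λ h → h U) b {f} {0E}

  monomial : Carrier → Subset n → E
  monomial k S U = if U ≡ˢ S then k else 0#

  monomial-at : ∀ k S → monomial k S S ≡ k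
  monomial-at k S = cong (if_then k else 0#) (≡⇒≡ˢ refl)

  monomial-elsewhere : ∀ k {S U} → U ≢ S → monomial k S U ≡ 0#
  monomial-elsewhere k U≢S = cong (if_then k else 0#) (≢⇒≡ˢ-false U≢S)

  sgn² : ∀ m → sgn m * sgn m ≈ 1#
  sgn² ℕ.zero    = *-identityˡ 1#
  sgn² (ℕ.suc m) = begin
    - sgn m * - sgn m  ≈⟨ -‿distribˡ-* (sgn m) (- sgn m) ⟨
    - (sgn m * - sgn m) ≈⟨ -‿cong (-‿distribʳ-* (sgn m) (sgn m)) ⟨
    - - (sgn m * sgn m) ≈⟨ -‿involutive _ ⟩
    sgn m * sgn m       ≈⟨ sgn² m ⟩
    1#                  ∎

  monomial-scale : ∀ a k S U → a * monomial k S U ≈ monomial (a * k) S U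
  monomial-scale a k S U with U ≡ˢ S
  ... | true  = ≈-refl
  ... | false = zeroʳ a

  productTerm : E → E → Subset n → Subset n → Subset n → Carrier
  productTerm f g U S T = if ((S ∩ T) ≡ˢ Sub.⊥) ∧ ((S ∪ T) ≡ˢ U) then sgn (inv S T) * (f S * g T) else 0#

  productTerm-split : ∀ f g {U S T} → S ∩ T ≡ Sub.⊥ → S ∪ T ≡ U → productTerm f g U S T ≡ sgn (inv S T) * (f S * g T)
  productTerm-split f g {U} {S} {T} S∩T≡⊥ S∪T≡U =
    cong₂ (λ a b → if a ∧ b then sgn (inv S T) * (f S * g T) else 0#) (≡⇒≡ˢ S∩T≡⊥) (≡⇒≡ˢ S∪T≡U)

  productTerm-zero : ∀ f g U S T → (S ∩ T ≡ Sub.⊥ → S ∪ T ≡ U → sgn (inv S T) * (f S * g T) ≈ 0#) →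
                     productTerm f g U S T ≈ 0#
  productTerm-zero f g U S T term≈0 with Vec.≡-dec Bool._≟_ (S ∩ T) Sub.⊥ | Vec.≡-dec Bool._≟_ (S ∪ T) U
  ... | yes S∩T≡⊥ | yes S∪T≡U = term≈0 S∩T≡⊥ S∪T≡U
  ... | yes _     | no  _     = ≈-refl
  ... | no  _     | _         = ≈-refl

  productTerm-cong : ∀ f f′ g g′ U S T → (S ∩ T ≡ Sub.⊥ → S ∪ T ≡ U → f S * g T ≈ f′ S * g′ T) →
                     productTerm f g U S T ≈ productTerm f′ g′ U S T
  productTerm-cong f f′ g g′ U S T fg≈f′g′ with Vec.≡-dec Bool._≟_ (S ∩ T) Sub.⊥ | Vec.≡-dec Bool._≟_ (S ∪ T) U
  ... | yes S∩T≡⊥ | yes S∪T≡U = *-congˡ (fg≈f′g′ S∩T≡⊥ S∪T≡U)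
  ... | yes _     | no  _     = ≈-refl
  ... | no  _     | _         = ≈-refl

  productTerm-zeroˡ : ∀ f g U S T → f S ≈ 0# → productTerm f g U S T ≈ 0#
  productTerm-zeroˡ f g U S T fS≈0 = productTerm-zero f g U S T (λ _ _ → begin
    sgn (inv S T) * (f S * g T) ≈⟨ *-congˡ (*-congʳ fS≈0) ⟩
    sgn (inv S T) * (0# * g T)  ≈⟨ *-congˡ (zeroˡ (g T)) ⟩
    sgn (inv S T) * 0#          ≈⟨ zeroʳ _ ⟩
    0#                          ∎)

  productTerm-zeroʳ : ∀ f g U S T → g T ≈ 0# → productTerm f g U S T ≈ 0#
  productTerm-zeroʳ f g U S T gT≈0 = productTerm-zero f g U S T (λ _ _ → begin
    sgn (inv S T) * (f S * g T) ≈⟨ *-congˡ (*-congˡ gT≈0) ⟩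
    sgn (inv S T) * (f S * 0#)  ≈⟨ *-congˡ (zeroʳ (f S)) ⟩
    sgn (inv S T) * 0#          ≈⟨ zeroʳ _ ⟩
    0#                          ∎)

  productTerm-ifʳ : ∀ g f (B : Subset n → Bool) b U S T → (S ∩ T ≡ Sub.⊥ → S ∪ T ≡ U → B T ≡ b) →
                    (if b then productTerm g f U S T else 0#) ≈ productTerm g (λ T → if B T then f T else 0#) U S T
  productTerm-ifʳ g f B b U S T B≡b with Vec.≡-dec Bool._≟_ (S ∩ T) Sub.⊥ | Vec.≡-dec Bool._≟_ (S ∪ T) U
  ... | yes S∩T≡⊥ | yes S∪T≡U rewrite B≡b S∩T≡⊥ S∪T≡U = pull-if b
    where
    pull-if : ∀ b → (if b then sgn (inv S T) * (g S * f T) else 0#) ≈ sgn (inv S T) * (g S * (if b then f T else 0#))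
    pull-if true  = ≈-refl
    pull-if false = ≈-sym (≈-trans (*-congˡ (zeroʳ (g S))) (zeroʳ _))
  ... | yes _ | no _ = if-0-idem b
  ... | no _  | _    = if-0-idem b

  productTerm-ifˡ : ∀ f g (B : Subset n → Bool) b U S T → (S ∩ T ≡ Sub.⊥ → S ∪ T ≡ U → B S ≡ b) →
                    (if b then productTerm f g U S T else 0#) ≈ productTerm (λ S → if B S then f S else 0#) g U S T
  productTerm-ifˡ f g B b U S T B≡b with Vec.≡-dec Bool._≟_ (S ∩ T) Sub.⊥ | Vec.≡-dec Bool._≟_ (S ∪ T) U
  ... | yes S∩T≡⊥ | yes S∪T≡U rewrite B≡b S∩T≡⊥ S∪T≡U = pull-if b
    where
    pull-if : ∀ b → (if b then sgn (inv S T) * (f S * g T) else 0#) ≈ sgn (inv S T) * ((if b then f S else 0#) * g T)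
    pull-if true  = ≈-refl
    pull-if false = ≈-sym (≈-trans (*-congˡ (zeroˡ (g T))) (zeroʳ _))
  ... | yes _ | no _ = if-0-idem b
  ... | no _  | _    = if-0-idem b

  monomial-*E : ∀ k S f U → (monomial k S *E f) U ≈ ∑ subsets (productTerm (monomial k S) f U S)
  monomial-*E k S f U = ∑-subsets-single _ S (λ S′ S′≢S → ∑-zero subsets (λ T →
    productTerm-zeroˡ (monomial k S) f U S′ T (≈-reflexive (monomial-elsewhere k S′≢S))))

  *E-monomial : ∀ k S f U → (f *E monomial k S) U ≈ ∑ subsets (λ T → productTerm f (monomial k S) U T S)
  *E-monomial k S f U = ∑-cong subsets (λ T → ∑-subsets-single _ S (λ S′ S′≢S →
    productTerm-zeroʳ f (monomial k S) U T S′ (≈-reflexive (monomial-elsewhere k S′≢S))))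

  *E-expandˡ : ∀ a f → (a *E f) ≈E sumE subsets (λ S → monomial (a S) S *E f)
  *E-expandˡ a f U = ≈-sym (begin
    ∑ subsets (λ S → (monomial (a S) S *E f) U)                ≈⟨ ∑-cong subsets (λ S → monomial-*E (a S) S f U) ⟩
    ∑ subsets (λ S → ∑ subsets (productTerm (monomial (a S) S) f U S))
      ≈⟨ ∑-cong subsets (λ S → ∑-cong subsets (λ T → productTerm-cong (monomial (a S) S) a f f U S T
           (λ _ _ → *-congʳ (≈-reflexive (monomial-at (a S) S))))) ⟩
    (a *E f) U                                                  ∎)

  *E-expandʳ : ∀ a f → (f *E a) ≈E sumE subsets (λ S → f *E monomial (a S) S)
  *E-expandʳ a f U = ≈-sym (begin
    ∑ subsets (λ S → (f *E monomial (a S) S) U)                 ≈⟨ ∑-cong subsets (λ S → *E-monomial (a S) S f U) ⟩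
    ∑ subsets (λ S → ∑ subsets (λ T → productTerm f (monomial (a S) S) U T S))
      ≈⟨ ∑-cong subsets (λ S → ∑-cong subsets (λ T → productTerm-cong f f (monomial (a S) S) a U T S
           (λ _ _ → *-congˡ (≈-reflexive (monomial-at (a S) S))))) ⟩
    ∑ subsets (λ S → ∑ subsets (λ T → productTerm f a U T S))   ≈⟨ ∑-comm subsets subsets _ ⟩
    (f *E a) U                                                  ∎)

  inv-⊥ : ∀ T → inv Sub.⊥ T ≡ 0
  inv-⊥ T = ListSum.∑-zero ℕ.+-0-commutativeMonoid (allFin n)
    (λ s → cong (if_then below T s else 0) (Vec.lookup-replicate s false))

  monomial⊥-*E : ∀ k f → (monomial k Sub.⊥ *E f) ≈E (λ U → k * f U)
  monomial⊥-*E k f U = begin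
    (monomial k Sub.⊥ *E f) U                            ≈⟨ monomial-*E k Sub.⊥ f U ⟩
    ∑ subsets (productTerm (monomial k Sub.⊥) f U Sub.⊥) ≈⟨ ∑-subsets-single _ U others ⟩
    productTerm (monomial k Sub.⊥) f U Sub.⊥ U           ≡⟨ productTerm-split (monomial k Sub.⊥) f (∩-zeroˡ U) (∪-identityˡ U) ⟩
    sgn (inv Sub.⊥ U) * (monomial k Sub.⊥ Sub.⊥ * f U)   ≡⟨ cong₂ (λ i m → sgn i * (m * f U)) (inv-⊥ U) (monomial-at k Sub.⊥) ⟩
    1# * (k * f U)                                       ≈⟨ *-identityˡ _ ⟩
    k * f U                                              ∎
    where
    others : ∀ T → T ≢ U → productTerm (monomial k Sub.⊥) f U Sub.⊥ T ≈ 0#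
    others T T≢U = productTerm-zero (monomial k Sub.⊥) f U Sub.⊥ T
      (λ _ ⊥∪T≡U → contradiction (≡.trans (≡.sym (∪-identityˡ T)) ⊥∪T≡U) T≢U)

  module _ {p} {Q : E → Set p} where

    Ideal-sumE : ∀ {A : Set} (xs : List A) {h : A → E} → (∀ x → Ideal Q (h x)) → Ideal Q (sumE xs h)
    Ideal-sumE []       _     = zer
    Ideal-sumE (x ∷ xs) ideal = add (ideal x) (Ideal-sumE xs ideal)

    Ideal-scale : ∀ k {f} → Ideal Q f → Ideal Q (λ U → k * f U)
    Ideal-scale k {f} f∈Q = resp (monomial⊥-*E k f) (lmul (monomial k Sub.⊥) f∈Q)

    Ideal-sub : ∀ {f g} → Ideal Q f → Ideal Q g → Ideal Q (f -E g)
    Ideal-sub {f} {g} f∈Q g∈Q = resp (λ U → +-congˡ (-1*x≈-x (g U))) (add f∈Q (Ideal-scale (- 1#) g∈Q))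

  ∂-summand : Subset n → Subset n → Fin n → Carrier
  ∂-summand D T i = if memb i D ∧ (T ≡ˢ (D - i)) then sgn (below D i) else 0#

  ∂-summand-zero : ∀ D T i → (i ∈ D → T ≢ D - i) → ∂-summand D T i ≈ 0#
  ∂-summand-zero D T i T≢D-i with memb i D in i∈D | Vec.≡-dec Bool._≟_ T (D - i)
  ... | true  | yes T≡D-i = contradiction T≡D-i (T≢D-i (memb⇒∈ i∈D))
  ... | true  | no  _     = ≈-refl
  ... | false | _         = ≈-refl

  ∂-zero : ∀ D T → (∀ i → i ∈ D → T ≢ D - i) → ∂ D T ≈ 0#
  ∂-zero D T T≢D-i = ∑-zero (allFin n) (λ i → ∂-summand-zero D T i (T≢D-i i))

  ∂-at : ∀ {D j} → j ∈ D → ∂ D (D - j) ≈ sgn (below D j)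
  ∂-at {D} {j} j∈D = begin
    ∂ D (D - j)         ≈⟨ ∑-allFin-single (∂-summand D (D - j)) j (λ i i≢j →
                             ∂-summand-zero D (D - j) i (λ _ D-j≡D-i → i≢j (p-x≡p-y⇒x≡y j∈D (≡.sym D-j≡D-i)))) ⟩
    ∂-summand D (D - j) j ≡⟨ cong₂ (λ a b → if a ∧ b then sgn (below D j) else 0#) (Vec.[]=⇒lookup j∈D) (≡⇒≡ˢ refl) ⟩
    sgn (below D j)     ∎

  ∂-DegLe : ∀ D → DegLe (∣ D ∣ ℕ.∸ 1) (∂ D)
  ∂-DegLe D T ∣D∣∸1<∣T∣ = ∂-zero D T (λ i i∈D T≡D-i →
    ℕ.<⇒≱ ∣D∣∸1<∣T∣ (ℕ.≤-reflexive (≡.trans (cong ∣_∣ T≡D-i) (∣p-x∣≡∣p∣∸1 i∈D))))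

  ∂-vanishes : ∀ {D j T} → j ∈ D → j ∉ T → T ≢ D - j → ∂ D T ≈ 0#
  ∂-vanishes {D} {j} {T} j∈D j∉T T≢D-j = ∂-zero D T λ i i∈D T≡D-i → case i Fin.≟ j of λ where
    (yes refl) → T≢D-j T≡D-i
    (no  i≢j)  → j∉T (≡.subst (j ∈_) (≡.sym T≡D-i) (x∈p∧x≢y⇒x∈p-y j∈D (i≢j ∘ ≡.sym)))

  ⁅j⁆-*E-∂ : ∀ {D j} → j ∈ D → (mono ⁅ j ⁆ *E ∂ D) ≈E monomial (sgn (inv ⁅ j ⁆ (D - j)) * sgn (below D j)) D
  ⁅j⁆-*E-∂ {D} {j} j∈D U = begin
    (mono ⁅ j ⁆ *E ∂ D) U                              ≈⟨ monomial-*E 1# ⁅ j ⁆ (∂ D) U ⟩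
    ∑ subsets (productTerm (mono ⁅ j ⁆) (∂ D) U ⁅ j ⁆)  ≈⟨ ∑-subsets-single _ (D - j) others ⟩
    productTerm (mono ⁅ j ⁆) (∂ D) U ⁅ j ⁆ (D - j)      ≈⟨ at-D-j (Vec.≡-dec Bool._≟_ U D) ⟩
    monomial s D U                                     ∎
    where
    s : Carrier
    s = sgn (inv ⁅ j ⁆ (D - j)) * sgn (below D j)
    others : ∀ T → T ≢ D - j → productTerm (mono ⁅ j ⁆) (∂ D) U ⁅ j ⁆ T ≈ 0#
    others T T≢D-j = productTerm-zero (mono ⁅ j ⁆) (∂ D) U ⁅ j ⁆ T λ ⁅j⁆∩T≡⊥ _ → begin
      sgn (inv ⁅ j ⁆ T) * (mono ⁅ j ⁆ ⁅ j ⁆ * ∂ D T) ≈⟨ *-congˡ (*-congˡ (∂-vanishes j∈D (⁅x⁆∩p≡⊥⇒x∉p ⁅j⁆∩T≡⊥) T≢D-j)) ⟩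
      sgn (inv ⁅ j ⁆ T) * (mono ⁅ j ⁆ ⁅ j ⁆ * 0#)    ≈⟨ *-congˡ (zeroʳ _) ⟩
      sgn (inv ⁅ j ⁆ T) * 0#                       ≈⟨ zeroʳ _ ⟩
      0#                                           ∎
    at-D-j : Dec (U ≡ D) → productTerm (mono ⁅ j ⁆) (∂ D) U ⁅ j ⁆ (D - j) ≈ monomial s D U
    at-D-j (yes refl) = begin
      productTerm (mono ⁅ j ⁆) (∂ D) D ⁅ j ⁆ (D - j)
        ≡⟨ productTerm-split (mono ⁅ j ⁆) (∂ D) (⁅x⁆∩[p-x]≡⊥ j D) (⁅x⁆∪[p-x]≡p j∈D) ⟩
      sgn (inv ⁅ j ⁆ (D - j)) * (mono ⁅ j ⁆ ⁅ j ⁆ * ∂ D (D - j))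
        ≈⟨ *-congˡ (*-cong (≈-reflexive (monomial-at 1# ⁅ j ⁆)) (∂-at j∈D)) ⟩
      sgn (inv ⁅ j ⁆ (D - j)) * (1# * sgn (below D j))
        ≈⟨ *-congˡ (*-identityˡ _) ⟩
      s
        ≡⟨ monomial-at s D ⟨
      monomial s D D ∎
    at-D-j (no U≢D) = begin
      productTerm (mono ⁅ j ⁆) (∂ D) U ⁅ j ⁆ (D - j) ≈⟨ productTerm-zero (mono ⁅ j ⁆) (∂ D) U ⁅ j ⁆ (D - j) (λ _ ⁅j⁆∪[D-j]≡U →
                                                          contradiction (≡.trans (≡.sym ⁅j⁆∪[D-j]≡U) (⁅x⁆∪[p-x]≡p j∈D)) U≢D) ⟩
      0#                                             ≡⟨ monomial-elsewhere s U≢D ⟨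
      monomial s D U                                 ∎

  ∂-restrict : (Fin n → Bool) → Subset n → E
  ∂-restrict B S = sumE (allFin n) (λ i → if memb i S ∧ B i then monomial (sgn (below S i)) (S - i) else 0E)

  ∂-split : ∀ B S → ∂ S ≈E (∂-restrict B S +E ∂-restrict (not ∘ B) S)
  ∂-split B S U = ≈-trans (∑-cong (allFin n) split) (∑-+ (allFin n) _ _)
    where
    split : ∀ i → ∂-summand S U i ≈ ((if memb i S ∧ B i then monomial (sgn (below S i)) (S - i) else 0E) U
                                     + (if memb i S ∧ not (B i) then monomial (sgn (below S i)) (S - i) else 0E) U)
    split i with memb i S | B i
    ... | true  | true  = ≈-sym (+-identityʳ _)
    ... | true  | false = ≈-sym (+-identityˡ _)
    ... | false | _     = ≈-sym (+-identityˡ 0#)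

  module Projection {W : Set} (w : Subset n → W) (_▷_ : Subset n → W → W)
                    (w-∪ : ∀ S T → S ∩ T ≡ Sub.⊥ → w (S ∪ T) ≡ S ▷ w T) where

    π : (W → Bool) → E → E
    π P f U = if P (w U) then f U else 0#

    shift : Subset n → (W → Bool) → (W → Bool)
    shift S P v = P (S ▷ v)

    π-cong : ∀ P {f g} → f ≈E g → π P f ≈E π P g
    π-cong P f≈g U = if-0-cong (P (w U)) (f≈g U)

    π-0E : ∀ P → π P 0E ≈E 0E
    π-0E P U = if-0-idem (P (w U))

    π-+E : ∀ P f g → π P (f +E g) ≈E (π P f +E π P g)
    π-+E P f g U with P (w U)
    ... | true  = ≈-refl
    ... | false = ≈-sym (+-identityˡ 0#)

    π-sumE : ∀ P {A : Set} (xs : List A) h → π P (sumE xs h) ≈E sumE xs (λ x → π P (h x))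
    π-sumE P xs h U = ≈-sym (∑-if xs (P (w U)) (λ x → h x U))

    π-monomial-*E : ∀ P k S f → π P (monomial k S *E f) ≈E (monomial k S *E π (shift S P) f)
    π-monomial-*E P k S f U = begin
      π P (monomial k S *E f) U                                           ≈⟨ if-0-cong (P (w U)) (monomial-*E k S f U) ⟩
      (if P (w U) then ∑ subsets (productTerm (monomial k S) f U S) else 0#) ≈⟨ ∑-if subsets (P (w U)) _ ⟨
      ∑ subsets (λ T → if P (w U) then productTerm (monomial k S) f U S T else 0#)
        ≈⟨ ∑-cong subsets (λ T → productTerm-ifʳ (monomial k S) f (λ T → shift S P (w T)) (P (w U)) U S T
                                   (λ S∩T≡⊥ S∪T≡U → cong P (≡.trans (≡.sym (w-∪ S T S∩T≡⊥)) (cong w S∪T≡U)))) ⟩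
      ∑ subsets (productTerm (monomial k S) (π (shift S P) f) U S)          ≈⟨ monomial-*E k S (π (shift S P) f) U ⟨
      (monomial k S *E π (shift S P) f) U                                   ∎

    π-*E-monomial : ∀ P k S f → π P (f *E monomial k S) ≈E (π (shift S P) f *E monomial k S)
    π-*E-monomial P k S f U = begin
      π P (f *E monomial k S) U                                           ≈⟨ if-0-cong (P (w U)) (*E-monomial k S f U) ⟩
      (if P (w U) then ∑ subsets (λ T → productTerm f (monomial k S) U T S) else 0#) ≈⟨ ∑-if subsets (P (w U)) _ ⟨
      ∑ subsets (λ T → if P (w U) then productTerm f (monomial k S) U T S else 0#)
        ≈⟨ ∑-cong subsets (λ T → productTerm-ifˡ f (monomial k S) (λ T → shift S P (w T)) (P (w U)) U T S
                                   (λ T∩S≡⊥ T∪S≡U → cong P (≡.trans (≡.sym (w-∪ S T (≡.trans (∩-comm S T) T∩S≡⊥)))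
                                                                    (cong w (≡.trans (∪-comm S T) T∪S≡U))))) ⟩
      ∑ subsets (λ T → productTerm (π (shift S P) f) (monomial k S) U T S) ≈⟨ *E-monomial k S (π (shift S P) f) U ⟨
      (π (shift S P) f *E monomial k S) U                                   ∎

    π-*Eˡ : ∀ P a f → π P (a *E f) ≈E sumE subsets (λ S → monomial (a S) S *E π (shift S P) f)
    π-*Eˡ P a f U = begin
      π P (a *E f) U                                               ≈⟨ π-cong P (*E-expandˡ a f) U ⟩
      π P (sumE subsets (λ S → monomial (a S) S *E f)) U           ≈⟨ π-sumE P subsets (λ S → monomial (a S) S *E f) U ⟩
      sumE subsets (λ S → π P (monomial (a S) S *E f)) U           ≈⟨ ∑-cong subsets (λ S → π-monomial-*E P (a S) S f U) ⟩
      sumE subsets (λ S → monomial (a S) S *E π (shift S P) f) U   ∎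

    π-*Eʳ : ∀ P a f → π P (f *E a) ≈E sumE subsets (λ S → π (shift S P) f *E monomial (a S) S)
    π-*Eʳ P a f U = begin
      π P (f *E a) U                                               ≈⟨ π-cong P (*E-expandʳ a f) U ⟩
      π P (sumE subsets (λ S → f *E monomial (a S) S)) U           ≈⟨ π-sumE P subsets (λ S → f *E monomial (a S) S) U ⟩
      sumE subsets (λ S → π P (f *E monomial (a S) S)) U           ≈⟨ ∑-cong subsets (λ S → π-*E-monomial P (a S) S f U) ⟩
      sumE subsets (λ S → π (shift S P) f *E monomial (a S) S) U   ∎

    π-Ideal : (Good : (W → Bool) → Set) → (∀ S {P} → Good P → Good (shift S P)) →
              ∀ {p q} {Q : E → Set p} {Q′ : E → Set q} →
              (∀ {f} → Q f → ∀ {P} → Good P → Ideal Q′ (π P f)) →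
              ∀ {f} → Ideal Q f → ∀ {P} → Good P → Ideal Q′ (π P f)
    π-Ideal Good shift-Good π-gen = go
      where
      go : ∀ {f} → Ideal _ f → ∀ {P} → Good P → Ideal _ (π P f)
      go (gen Qf)            good = π-gen Qf good
      go zer           {P}   good = resp (λ U → ≈-sym (π-0E P U)) zer
      go (add {f} {g} f∈ g∈) {P} good = resp (λ U → ≈-sym (π-+E P f g U)) (add (go f∈ good) (go g∈ good))
      go (lmul {f} a f∈) {P} good = resp (λ U → ≈-sym (π-*Eˡ P a f U))
        (Ideal-sumE subsets (λ S → lmul (monomial (a S) S) (go f∈ (shift-Good S good))))
      go (rmul {f} a f∈) {P} good = resp (λ U → ≈-sym (π-*Eʳ P a f U))
        (Ideal-sumE subsets (λ S → rmul (monomial (a S) S) (go f∈ (shift-Good S good))))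
      go (resp f≈g f∈)   {P} good = resp (π-cong P f≈g) (go f∈ good)

    π-∂ : ∀ P S → π P (∂ S) ≈E ∂-restrict (λ i → P (w (S - i))) S
    π-∂ P S U = begin
      π P (∂ S) U                                                  ≈⟨ ∑-if (allFin n) (P (w U)) (∂-summand S U) ⟨
      ∑ (allFin n) (λ i → if P (w U) then ∂-summand S U i else 0#) ≈⟨ ∑-cong (allFin n) summand ⟩
      ∂-restrict (λ i → P (w (S - i))) S U                         ∎
      where
      summand : ∀ i → (if P (w U) then ∂-summand S U i else 0#) ≈
                      (if memb i S ∧ P (w (S - i)) then monomial (sgn (below S i)) (S - i) else 0E) U
      summand i with memb i S | Vec.≡-dec Bool._≟_ U (S - i)
      ... | false | _         = if-0-idem (P (w U))
      ... | true  | yes refl  = ≈-sym (begin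
        (if P (w (S - i)) then monomial _ (S - i) else 0E) (S - i)     ≡⟨ if-0E-at (P (w (S - i))) _ (S - i) ⟩
        (if P (w (S - i)) then monomial _ (S - i) (S - i) else 0#)     ≡⟨ cong (if P (w (S - i)) then_else 0#) (monomial-at _ (S - i)) ⟩
        (if P (w (S - i)) then sgn (below S i) else 0#)                ∎)
      ... | true  | no  U≢S-i = ≈-trans (if-0-idem (P (w U))) (≈-sym (begin
        (if P (w (S - i)) then monomial _ (S - i) else 0E) U ≡⟨ if-0E-at (P (w (S - i))) _ U ⟩
        (if P (w (S - i)) then monomial _ (S - i) U else 0#) ≡⟨ cong (if P (w (S - i)) then_else 0#) (monomial-elsewhere _ U≢S-i) ⟩
        (if P (w (S - i)) then 0# else 0#)                   ≈⟨ if-0-idem (P (w (S - i))) ⟩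
        0#                                                   ∎))

module DirectSum {c ℓ : Level} (K : CommutativeRing c ℓ) (n : ℕ) (M : Matroid n) (r : ℕ) where
  open CommutativeRing K hiding (_-_) renaming (refl to ≈-refl; sym to ≈-sym; trans to ≈-trans; reflexive to ≈-reflexive)
  open import Relation.Binary.Reasoning.Setoid setoid
  open Exterior K n
  open Exterior.WithMatroid K n M
  open ExteriorAlgebra K n
  open AbelianListSum +-abelianGroup
  open Matroid M
  open MatroidNotions M
  open RClosure M r
  open import Algebra.Properties.Ring ring using (x≈z//y)
  open import Algebra.Properties.CommutativeSemigroup *-commutativeSemigroup using (interchange)

  Weight : Set
  Weight = Subset n × ℕ

  weight : Subset n → Weight
  weight U = cᵣ r U , ∣ U ∣

  _▷_ : Subset n → Weight → Weight
  S ▷ (X , d) = cᵣ r (S ∪ X) , ∣ S ∣ ℕ.+ d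

  weight-∪ : ∀ S T → S ∩ T ≡ Sub.⊥ → weight (S ∪ T) ≡ S ▷ weight T
  weight-∪ S T S∩T≡⊥ = cong₂ _,_ (≡.sym (cᵣ[S∪cᵣT]≡cᵣ[S∪T] S T)) (∣p∪q∣≡∣p∣+∣q∣ S T S∩T≡⊥)

  open Projection weight _▷_ weight-∪

  DegreeBounded : (Weight → Bool) → Set
  DegreeBounded P = ∀ X d → P (X , d) ≡ true → d ≤ r

  shift-DegreeBounded : ∀ S {P} → DegreeBounded P → DegreeBounded (shift S P)
  shift-DegreeBounded S bounded X d Pd = ℕ.m+n≤o⇒n≤o ∣ S ∣ (bounded _ _ Pd)

  ∂∈J : ∀ {D} → indep D ≡ false → ∣ D ∣ ℕ.∸ 1 ≤ r → J r (∂ D)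
  ∂∈J {D} D-dep ∣D∣∸1≤r = gen (gen (D , D-dep , refl) , λ U r<∣U∣ → ∂-DegLe D U (ℕ.≤-<-trans ∣D∣∸1≤r r<∣U∣))

  dependent-nonempty : ∀ {D} → indep D ≡ false → Nonempty D
  dependent-nonempty {D} D-dep with nonempty? D
  ... | yes D≠∅ = D≠∅
  ... | no  D≡∅ = contradiction (≡.trans (≡.sym D-dep) (≡.trans (cong indep (Empty-unique D≡∅)) indep-empty)) λ ()

  dependent-monomial∈J : ∀ {D} → indep D ≡ false → ∣ D ∣ ≤ r → ∀ k → J r (monomial k D)
  dependent-monomial∈J {D} D-dep ∣D∣≤r k with dependent-nonempty D-dep
  ... | j , j∈D = resp rescale (Ideal-scale (k * s) ±e_D∈J)
    where
    s : Carrier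
    s = sgn (inv ⁅ j ⁆ (D - j)) * sgn (below D j)
    ±e_D∈J : J r (monomial s D)
    ±e_D∈J = resp (⁅j⁆-*E-∂ j∈D) (lmul (mono ⁅ j ⁆) (∂∈J D-dep (ℕ.≤-trans (ℕ.m∸n≤m ∣ D ∣ 1) ∣D∣≤r)))
    s²≈1 : s * s ≈ 1#
    s²≈1 = begin
      s * s                                                       ≈⟨ interchange _ _ _ _ ⟩
      (sgn (inv ⁅ j ⁆ (D - j)) * sgn (inv ⁅ j ⁆ (D - j))) * (sgn (below D j) * sgn (below D j))
        ≈⟨ *-cong (sgn² (inv ⁅ j ⁆ (D - j))) (sgn² (below D j)) ⟩
      1# * 1#                                                     ≈⟨ *-identityˡ 1# ⟩
      1#                                                          ∎
    rescale : ∀ U → (k * s) * monomial s D U ≈ monomial k D U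
    rescale U = ≈-trans (monomial-scale (k * s) s D U)
                        (if-0-cong (U ≡ˢ D) (≈-trans (*-assoc k s s) (≈-trans (*-congˡ s²≈1) (*-identityʳ k))))

  ∂-restrict∈J : ∀ B S → (∀ i → i ∈ S → B i ≡ true → indep (S - i) ≡ false × ∣ S - i ∣ ≤ r) → J r (∂-restrict B S)
  ∂-restrict∈J B S faces = Ideal-sumE (allFin n) face∈J
    where
    face∈J : ∀ i → J r (if memb i S ∧ B i then monomial (sgn (below S i)) (S - i) else 0E)
    face∈J i with memb i S in i∈S | B i in Bi
    ... | true  | true  = let S-i-dep , ∣S-i∣≤r = faces i (memb⇒∈ i∈S) Bi in dependent-monomial∈J S-i-dep ∣S-i∣≤r _
    ... | true  | false = zer
    ... | false | _     = zer

  faceWeight : Subset n → Weight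
  faceWeight S = cᵣ r S , ∣ S ∣ ℕ.∸ 1

  independent-face-weight : ∀ {S i} → indep S ≡ false → i ∈ S → indep (S - i) ≡ true → ∣ S - i ∣ ≤ r → weight (S - i) ≡ faceWeight S
  independent-face-weight S-dep i∈S S-i-indep ∣S-i∣≤r =
    cong₂ _,_ (cᵣ[S-x]≡cᵣS S-dep i∈S S-i-indep ∣S-i∣≤r) (∣p-x∣≡∣p∣∸1 i∈S)

  face-dependent : ∀ {S i} (P : Weight → Bool) → indep S ≡ false → i ∈ S → ∣ S - i ∣ ≤ r →
                   P (weight (S - i)) ≡ not (P (faceWeight S)) → indep (S - i) ≡ false
  face-dependent {S} {i} P S-dep i∈S ∣S-i∣≤r P-flips with indep (S - i) in S-i-indep
  ... | true  = contradiction P-flips (not-¬ (cong P (independent-face-weight S-dep i∈S S-i-indep ∣S-i∣≤r)))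
  ... | false = refl

  π-∂∈J : ∀ {S P} → indep S ≡ false → DegreeBounded P → J r (π P (∂ S))
  π-∂∈J {S} {P} S-dep bounded = by-value-at-faceWeight (P (faceWeight S)) refl
    where
    B : Fin n → Bool
    B i = P (weight (S - i))
    by-value-at-faceWeight : ∀ b → P (faceWeight S) ≡ b → J r (π P (∂ S))
    by-value-at-faceWeight false P₀ = resp (λ U → ≈-sym (π-∂ P S U)) (∂-restrict∈J B S λ i i∈S Bi →
      let ∣S-i∣≤r = bounded _ _ Bi
      in face-dependent P S-dep i∈S ∣S-i∣≤r (≡.trans Bi (cong not (≡.sym P₀))) , ∣S-i∣≤r)
    by-value-at-faceWeight true P₀ = resp (λ U → ≈-sym (≈-trans (π-∂ P S U) (x≈z//y _ _ (∂ S U) (≈-sym (∂-split B S U)))))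
      (Ideal-sub (∂∈J S-dep (bounded _ _ P₀)) (∂-restrict∈J (not ∘ B) S λ i i∈S ¬Bi →
        let ∣S-i∣≤r = ℕ.≤-trans (ℕ.≤-reflexive (∣p-x∣≡∣p∣∸1 i∈S)) (bounded _ _ P₀)
        in face-dependent P S-dep i∈S ∣S-i∣≤r (≡.trans (not-injective ¬Bi) (cong not (≡.sym P₀))) , ∣S-i∣≤r))

  π-I∈J : ∀ {f} → I f → ∀ {P} → DegreeBounded P → J r (π P f)
  π-I∈J = π-Ideal DegreeBounded shift-DegreeBounded λ { (S , S-dep , refl) → π-∂∈J S-dep }

  truncate : (Weight → Bool) → (Weight → Bool)
  truncate P (X , d) = P (X , d) ∧ isYes (d ℕ.≤? r)

  truncate-DegreeBounded : ∀ P → DegreeBounded (truncate P)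
  truncate-DegreeBounded P X d truncated with P (X , d) | d ℕ.≤? r
  ... | true  | yes d≤r = d≤r
  truncate-DegreeBounded P X d () | true  | no _
  truncate-DegreeBounded P X d () | false | _

  π-truncate : ∀ P {f} → DegLe r f → π (truncate P) f ≈E π P f
  π-truncate P {f} deg≤r U with P (weight U) | ∣ U ∣ ℕ.≤? r
  ... | true  | yes _     = ≈-refl
  ... | true  | no  ∣U∣≰r = ≈-sym (deg≤r U (ℕ.≰⇒> ∣U∣≰r))
  ... | false | _         = ≈-refl

  π-J∈J : ∀ {f} → J r f → ∀ P → J r (π P f)
  π-J∈J f∈J P = π-Ideal (λ _ → ⊤) (λ _ _ → tt)
    (λ { (f∈I , deg≤r) {P} _ → resp (π-truncate P deg≤r) (π-I∈J f∈I (truncate-DegreeBounded P)) }) f∈J {P} tt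

  component : E → Subset n → E
  component f X = π (λ v → proj₁ v ≡ˢ X) f

  component∈J : ∀ {f} → J r f → ∀ X → J r (component f X)
  component∈J f∈J X = π-J∈J f∈J (λ v → proj₁ v ≡ˢ X)

  component-Family : ∀ f → Family r (component f)
  component-Family f X _ S cᵣS≢X = ≈-reflexive (cong (if_then f S else 0#) cᵣS≢X)

  Φ-component : ∀ f → Φ r (component f) ≈E f
  Φ-component f U = begin
    Φ r (component f) U                                        ≈⟨ ∑-subsets-single _ (cᵣ r U) others ⟩
    (if rClosed r (cᵣ r U) then component f (cᵣ r U) U else 0#) ≡⟨ cong₂ (λ a b → if a then (if b then f U else 0#) else 0#)
                                                                        (cᵣ-rClosed U) (≡⇒≡ˢ refl) ⟩
    f U                                                        ∎
    where
    others : ∀ X → X ≢ cᵣ r U → (if rClosed r X then component f X U else 0#) ≈ 0#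
    others X X≢cᵣU = ≈-trans (if-0-cong (rClosed r X) (≈-reflexive (cong (if_then f U else 0#) (≢⇒≡ˢ-false (X≢cᵣU ∘ ≡.sym)))))
                             (if-0-idem (rClosed r X))

  component-Φ : ∀ {g} → Family r g → ∀ {X} → rClosed r X ≡ true → component (Φ r g) X ≈E g X
  component-Φ {g} family {X} X-closed U with cᵣ r U ≡ˢ X in cᵣU≡X
  ... | false = ≈-sym (family X X-closed U cᵣU≡X)
  ... | true  = begin
    Φ r g U                                       ≈⟨ ∑-subsets-single _ X others ⟩
    (if rClosed r X then g X U else 0#)           ≡⟨ cong (if_then g X U else 0#) X-closed ⟩
    g X U                                         ∎
    where
    others : ∀ Y → Y ≢ X → (if rClosed r Y then g Y U else 0#) ≈ 0#
    others Y Y≢X with rClosed r Y in Y-closed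
    ... | true  = family Y Y-closed U (≢⇒≡ˢ-false λ cᵣU≡Y → Y≢X (≡.trans (≡.sym cᵣU≡Y) (≡ˢ⇒≡ cᵣU≡X)))
    ... | false = ≈-refl

  Φ-sub∈J : ∀ {g g′} → (∀ X → rClosed r X ≡ true → J r (g X -E g′ X)) → J r (Φ r g -E Φ r g′)
  Φ-sub∈J {g} {g′} differences∈J = resp sum-of-differences (Ideal-sumE subsets difference∈J)
    where
    difference : Subset n → E
    difference X = if rClosed r X then g X -E g′ X else 0E
    difference∈J : ∀ X → J r (difference X)
    difference∈J X with rClosed r X in X-closed
    ... | true  = differences∈J X X-closed
    ... | false = zer
    sum-of-differences : sumE subsets difference ≈E (Φ r g -E Φ r g′)
    sum-of-differences U = ≈-trans (∑-cong subsets termwise) (∑-sub subsets _ _)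
      where
      termwise : ∀ X → difference X U ≈ (if rClosed r X then g X U else 0#) + - (if rClosed r X then g′ X U else 0#)
      termwise X with rClosed r X
      ... | true  = ≈-refl
      ... | false = ≈-sym (-‿inverseʳ 0#)

  f-Φ[component-f]∈J : ∀ f → J r (f -E Φ r (component f))
  f-Φ[component-f]∈J f = resp (λ U → ≈-sym (≈-trans (+-congˡ (-‿cong (Φ-component f U))) (-‿inverseʳ (f U)))) zer

  Φ∈J⇒summands∈J : ∀ {g} → Family r g → J r (Φ r g) → ∀ X → rClosed r X ≡ true → J r (g X)
  Φ∈J⇒summands∈J family Φg∈J X X-closed = resp (component-Φ family X-closed) (component∈J Φg∈J X)

lemma2p24 : {c ℓ : Level} (n : ℕ) (G : Matroid n) → MatroidNotions.Loopless G → MatroidNotions.NoMultiplePoints G →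
    (K : CommutativeRing c ℓ) (r : ℕ) → 1 ≤ r →
    Exterior.WithMatroid.DirectSumDecomposition K n G r
lemma2p24 n G _ _ K r _ =
    (λ _ _ _ _ → Φ-sub∈J)
  , (λ f → component f , component-Family f , f-Φ[component-f]∈J f)
  , (λ _ → Φ∈J⇒summands∈J)
  where open DirectSum K n G r
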